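{- Let $\mathbb{B}=\{0,1\}$ and $A=\mathbb{B}^{\mathbb{N}}$. The scheme $\mathsf{GDC}_{A\mathbb{N}}$ ("for every predicate $T$ on $(A\times\mathbb{N})^*$, if $T$ is $A$-$\mathbb{N}$-approximable then $T$ has an $A$-$\mathbb{N}$-choice function") is inconsistent, and so is the scheme $\mathsf{GBI}_{A\mathbb{N}}$ ("for every predicate $T$ on $(A\times\mathbb{N})^*$, if $T$ is $A$-$\mathbb{N}$-barred then $T$ is inductively $A$-$\mathbb{N}$-barred").
   Context: Elements of $A=\mathbb{B}^{\mathbb{N}}$ are compared with extensional equality. For sets $A,B$, $(A\times B)^*$ is the set of finite sequences $v$ of pairs, $\langle\rangle$ empty, $v\star(a,b)$ extension; $v\subseteq v'$ means every pair in $v$ occurs in $v'$; $\mathrm{dom}(v)=\{a\mid\exists b,(a,b)\text{ occurs in }v\}$; $T^{\downarrow}=\{v\mid\forall v'\subseteq v,\ v'\in T\}$, $T^{\uparrow}=\{v\mid\exists v'\subseteq v,\ v'\in T\}$. $T$ is $A$-$B$-approximable if $\langle\rangle$ belongs to the greatest $X$ such that $X(v)$ implies $v\in T^{\downarrow}$ and $\forall a\notin\mathrm{dom}(v)\,\exists b\,X(v\star(a,b))$; inductively $A$-$B$-barred if $\langle\rangle$ belongs to the least $X$ with $X(v)$ whenever $v\in T^{\uparrow}$ or $\exists a\notin\mathrm{dom}(v)\,\forall b\,X(v\star(a,b))$. For $\alpha:A\to B$, $v\prec\alpha$ means $\alpha(a)=b$ for all $(a,b)$ in $v$; $T$ has an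 $A$-$B$-choice function if $\exists\alpha\,\forall v\,(v\prec\alpha\Rightarrow v\in T)$; $T$ is $A$-$B$-barred if $\forall\alpha\,\exists v\,(v\prec\alpha\wedge v\in T)$. "Inconsistent" means that adding all instances of the scheme to the (classical higher-order arithmetic) metatheory yields a contradiction. -}

module Defs where

open import Level using (0ℓ)
open import Data.Bool using (Bool)
open import Data.Nat using (ℕ)
open import Data.List using (List; []; _∷ʳ_)
open import Data.List.Relation.Unary.Any using (Any)
open import Data.List.Relation.Binary.Pointwise using (Pointwise)
open import Data.Product using (Σ; ∃; ∃-syntax; _×_; _,_; proj₁; proj₂)
open import Relation.Binary.PropositionalEquality using (_≡_)
open import Relation.Nullary using (¬_)
open import Axiom.ExcludedMiddle using (ExcludedMiddle) public

𝔹 : Set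
𝔹 = Bool

A : Set
A = ℕ → 𝔹

_≈_ : A → A → Set
a ≈ a' = ∀ n → a n ≡ a' n

Seq : Set
Seq = List (A × ℕ)

_⋆_ : Seq → A × ℕ → Seq
v ⋆ p = v ∷ʳ p

Occurs : A → ℕ → Seq → Set
Occurs a b v = Any (λ p → (proj₁ p ≈ a) × (proj₂ p ≡ b)) v

_⊆_ : Seq → Seq → Set
v ⊆ v' = ∀ a b → Occurs a b v → Occurs a b v'

Dom : Seq → A → Set
Dom v a = ∃[ b ] Occurs a b v

Pred : Set₁
Pred = Seq → Set

Extensional : Pred → Set
Extensional T = ∀ v v' →
  Pointwise (λ p q → (proj₁ p ≈ proj₁ q) × (proj₂ p ≡ proj₂ q)) v v' → T v → T v'

_↓ : Pred → Pred
(T ↓) v = ∀ v' → v' ⊆ v → T v'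

_↑ : Pred → Pred
(T ↑) v = ∃[ v' ] (v' ⊆ v × T v')

-- approximable: ⟨⟩ lies in the greatest X with the given closure property,
-- i.e. in some post-fixed point X (Knaster–Tarski)
Approximable : Pred → Set₁
Approximable T = Σ Pred λ X → X [] ×
  (∀ v → X v → (T ↓) v × (∀ a → ¬ Dom v a → ∃[ b ] X (v ⋆ (a , b))))

-- inductively barred: least X, as an inductive family
data IndBarredAt (T : Pred) : Seq → Set where
  base : ∀ {v} → (T ↑) v → IndBarredAt T v
  step : ∀ {v} a → ¬ Dom v a → (∀ b → IndBarredAt T (v ⋆ (a , b))) → IndBarredAt T v

InductivelyBarred : Pred → Set
InductivelyBarred T = IndBarredAt T []

ExtFun : (A → ℕ) → Set
ExtFun α = ∀ a a' → a ≈ a' → α a ≡ α a'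

_≺_ : Seq → (A → ℕ) → Set
v ≺ α = ∀ a b → Occurs a b v → α a ≡ b

HasChoiceFunction : Pred → Set
HasChoiceFunction T = ∃[ α ] (ExtFun α × (∀ v → v ≺ α → T v))

Barred : Pred → Set
Barred T = ∀ α → ExtFun α → ∃[ v ] (v ≺ α × T v)

GDC-Aℕ : Set₁
GDC-Aℕ = ∀ (T : Pred) → Extensional T → Approximable T → HasChoiceFunction T

GBI-Aℕ : Set₁
GBI-Aℕ = ∀ (T : Pred) → Extensional T → Barred T → InductivelyBarred T

-- Call a sequence injective if no label b ∈ ℕ is paired with two different
-- elements of A. Injectivity is approximable: a fresh label larger than all
-- labels used so far keeps any sequence injective. So GDC would give a choice
-- function α : A → ℕ all of whose finite graphs are injective, i.e. an
-- injection of 2^ℕ into ℕ, contradicting Cantor's theorem. Dually, by Cantor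
-- every α : A → ℕ has a collision, so "contains a collision" is barred; but it
-- is not inductively barred, since answering every query with a fresh label
-- keeps the sequence injective forever.
module Submission where

open import Defs
open import Level using (0ℓ)
open import Data.Product using (_×_)
open import Relation.Nullary using (¬_)

open import Axiom.DoubleNegationElimination using (em⇒dne)
open import Data.Bool using (false)
open import Data.Bool.Properties using (_≟_)
open import Data.Nat using (ℕ; suc; _+_; _<_)
open import Data.Nat.Properties using (≤-trans; m≤m+n; m≤n+m; <-irrefl)
open import Data.List using ([]; _∷_)
open import Data.List.Relation.Unary.Any using (here; there)
open import Data.List.Relation.Unary.Any.Properties using (++⁻)
open import Data.List.Relation.Binary.Pointwise using (Pointwise; _∷_)
open import Data.List.Relation.Binary.Pointwise.Properties using (symmetric)
open import Data.Product using (∃-syntax; _,_; proj₁; proj₂)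
open import Data.Sum using (inj₁; inj₂)
open import Data.Empty using (⊥-elim)
open import Function using (case_of_)
open import Relation.Nullary using (yes; no)
open import Relation.Nullary.Decidable using (isYes; decidable-stable)
open import Relation.Binary.PropositionalEquality using (_≡_; refl; sym; trans; cong)

≈-refl : ∀ {a} → a ≈ a
≈-refl n = refl

≈-sym : ∀ {a a'} → a ≈ a' → a' ≈ a
≈-sym e n = sym (e n)

≈-trans : ∀ {a a' a''} → a ≈ a' → a' ≈ a'' → a ≈ a''
≈-trans e e' n = trans (e n) (e' n)

≈-stable : ∀ {a a'} → ¬ ¬ (a ≈ a') → a ≈ a'
≈-stable {a} {a'} ¬¬e n =
  decidable-stable (a n ≟ a' n) (λ ¬e → ¬¬e (λ e → ¬e (e n)))

_≋_ : A × ℕ → A × ℕ → Set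
p ≋ q = (proj₁ p ≈ proj₁ q) × (proj₂ p ≡ proj₂ q)

≋-sym : ∀ {p q} → p ≋ q → q ≋ p
≋-sym (e , eb) = ≈-sym e , sym eb

Occurs-resp-≋ : ∀ {v v' a b} → Pointwise _≋_ v v' → Occurs a b v → Occurs a b v'
Occurs-resp-≋ ((e , eb) ∷ _)  (here (e' , eb')) =
  here (≈-trans (≈-sym e) e' , trans (sym eb) eb')
Occurs-resp-≋ (_ ∷ v≋v')      (there o)         = there (Occurs-resp-≋ v≋v' o)

Injective : Pred
Injective v = ∀ a a' b → Occurs a b v → Occurs a' b v → a ≈ a'

HasCollision : Pred
HasCollision v = ∃[ a ] ∃[ a' ] ∃[ b ] (Occurs a b v × Occurs a' b v × ¬ (a ≈ a'))

Injective-extensional : Extensional Injective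
Injective-extensional v v' v≋v' inj a a' b o o' =
  inj a a' b (Occurs-resp-≋ v'≋v o) (Occurs-resp-≋ v'≋v o')
  where
  v'≋v : Pointwise _≋_ v' v
  v'≋v = symmetric ≋-sym v≋v'

HasCollision-extensional : Extensional HasCollision
HasCollision-extensional v v' v≋v' (a , a' , b , o , o' , a≉a') =
  a , a' , b , Occurs-resp-≋ v≋v' o , Occurs-resp-≋ v≋v' o' , a≉a'

Injective-↓ : ∀ v → Injective v → (Injective ↓) v
Injective-↓ v inj v' v'⊆v a a' b o o' = inj a a' b (v'⊆v _ _ o) (v'⊆v _ _ o')

Injective⇒¬HasCollision-↑ : ∀ v → Injective v → ¬ (HasCollision ↑) v
Injective⇒¬HasCollision-↑ v inj (v' , v'⊆v , (a , a' , b , o , o' , a≉a')) =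
  a≉a' (Injective-↓ v inj v' v'⊆v a a' b o o')

fresh : Seq → ℕ
fresh []            = 0
fresh ((_ , b) ∷ v) = suc b + fresh v

Occurs⇒<fresh : ∀ {a b} v → Occurs a b v → b < fresh v
Occurs⇒<fresh ((_ , b) ∷ v) (here (_ , refl)) = m≤m+n (suc b) (fresh v)
Occurs⇒<fresh ((_ , b) ∷ v) (there o)         =
  ≤-trans (Occurs⇒<fresh v o) (m≤n+m (fresh v) (suc b))

Injective-⋆fresh : ∀ v a → Injective v → Injective (v ⋆ (a , fresh v))
Injective-⋆fresh v a inj a₁ a₂ b o₁ o₂ with ++⁻ v o₁ | ++⁻ v o₂
... | inj₁ p₁                | inj₁ p₂                = inj a₁ a₂ b p₁ p₂
... | inj₁ p₁                | inj₂ (here (_ , refl)) = ⊥-elim (<-irrefl refl (Occurs⇒<fresh v p₁))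
... | inj₂ (here (_ , refl)) | inj₁ p₂                = ⊥-elim (<-irrefl refl (Occurs⇒<fresh v p₂))
... | inj₂ (here (e₁ , _))   | inj₂ (here (e₂ , _))   = ≈-trans (≈-sym e₁) e₂

Injective-[] : Injective []
Injective-[] _ _ _ ()

Injective-approximable : Approximable Injective
Injective-approximable =
  Injective , Injective-[] ,
  λ v inj → Injective-↓ v inj , λ a _ → fresh v , Injective-⋆fresh v a inj

Injective⇒¬IndBarred-HasCollision : ∀ v → Injective v → ¬ IndBarredAt HasCollision v
Injective⇒¬IndBarred-HasCollision v inj (base collision↑) =
  Injective⇒¬HasCollision-↑ v inj collision↑
Injective⇒¬IndBarred-HasCollision v inj (step a _ next) =
  Injective⇒¬IndBarred-HasCollision _ (Injective-⋆fresh v a inj) (next (fresh v))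

¬IndBarred-HasCollision : ¬ InductivelyBarred HasCollision
¬IndBarred-HasCollision = Injective⇒¬IndBarred-HasCollision [] Injective-[]

collision-graph : ∀ {α a a'} → ExtFun α → α a ≡ α a' →
  ∃[ v ] (v ≺ α × Occurs a (α a) v × Occurs a' (α a) v)
collision-graph {α} {a} {a'} ext αa≡αa' =
  (a , α a) ∷ (a' , α a) ∷ [] , graph≺α , here (≈-refl , refl) , there (here (≈-refl , refl))
  where
  graph≺α : ((a , α a) ∷ (a' , α a) ∷ []) ≺ α
  graph≺α x b (here (a≈x , refl))          = sym (ext a x a≈x)
  graph≺α x b (there (here (a'≈x , refl))) = trans (sym (ext a' x a'≈x)) (sym αa≡αa')

choice-function-injective : ∀ {α} → ExtFun α → (∀ v → v ≺ α → Injective v) →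
  ∀ a a' → α a ≡ α a' → a ≈ a'
choice-function-injective ext choice a a' αa≡αa' =
  let v , v≺α , o , o' = collision-graph ext αa≡αa' in choice v v≺α a a' _ o o'

module _ (lem : ExcludedMiddle 0ℓ) where

  FalseOnPreimage : (A → ℕ) → ℕ → Set
  FalseOnPreimage α n = ∃[ a ] (α a ≡ n × a n ≡ false)

  diagonal : (A → ℕ) → A
  diagonal α n = isYes (lem {FalseOnPreimage α n})

  cantor : ∀ (α : A → ℕ) → ¬ (∀ a a' → α a ≡ α a' → a ≈ a')
  cantor α inj with lem {FalseOnPreimage α (α (diagonal α))} in eq
  ... | yes (a , αa≡αd , a[αd]≡false) =
    case trans (sym a[αd]≡false) (trans (inj a _ αa≡αd _) (cong isYes eq)) of λ ()
  ... | no ¬P = ¬P (diagonal α , refl , cong isYes eq)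

  collision : ∀ (α : A → ℕ) → ∃[ a ] ∃[ a' ] (α a ≡ α a' × ¬ (a ≈ a'))
  collision α = em⇒dne lem λ no-collision →
    cantor α λ a a' αa≡αa' → ≈-stable λ a≉a' → no-collision (a , a' , αa≡αa' , a≉a')

  HasCollision-barred : Barred HasCollision
  HasCollision-barred α ext =
    let a , a' , αa≡αa' , a≉a' = collision α
        v , v≺α , o , o' = collision-graph ext αa≡αa'
    in v , v≺α , a , a' , α a , o , o' , a≉a'

proposition14 : ExcludedMiddle 0ℓ → (¬ GDC-Aℕ) × (¬ GBI-Aℕ)
proposition14 lem = ¬gdc , ¬gbi
  where
  ¬gdc : ¬ GDC-Aℕ
  ¬gdc gdc =
    let α , ext , choice = gdc Injective Injective-extensional Injective-approximable
    in cantor lem α (choice-function-injective ext choice)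

  ¬gbi : ¬ GBI-Aℕ
  ¬gbi gbi =
    ¬IndBarred-HasCollision (gbi HasCollision HasCollision-extensional (HasCollision-barred lem))
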